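{- Let $(f_n)_{n\ge0}=(0,1,1,2,3,5,8,\dots)$ be the Fibonacci numbers. For every $n\ge1$, $f_n$ is the leading coefficient of both $\mathcal{H}_n(x)$ and $\widetilde{\mathcal{H}}_{n+1}(x)$.
   Context: $D'(a,b)$ is the number of lattice paths from $(0,0)$ to $(a,b)$ with steps in $\{(1,0),(1,1),(0,1),(0,2)\}$. For $m\ge0$, $\mathcal{H}_{m+1}(x)=\sum_{k=0}^mD'(m-k,k)x^k$, and $\mathcal{H}_m(x)=0$ for $m\le0$. $\widetilde{\mathcal{H}}_n(x)=\mathcal{H}_n(x)-x^2\mathcal{H}_{n-2}(x)$. -}

module Defs where

open import Data.Nat using (ℕ; zero; suc; _∸_)
import Data.Nat as ℕ
open import Data.Integer using (ℤ; +_; _-_; 0ℤ)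
open import Data.Integer using (_≟_)
open import Data.List using (List; []; _∷_; map; upTo)
open import Relation.Nullary using (yes; no)

fib : ℕ → ℕ
fib zero = zero
fib (suc zero) = suc zero
fib (suc (suc n)) = fib (suc n) ℕ.+ fib n

-- D' a b : number of lattice paths from (0,0) to (a,b) with steps in
-- {(1,0),(1,1),(0,1),(0,2)}, computed by classifying the paths by their
-- last step:  D'(0,0) = 1  and
-- D'(a,b) = D'(a-1,b) + D'(a-1,b-1) + D'(a,b-1) + D'(a,b-2),
-- where terms with a negative coordinate are omitted (they are 0).
D′ : ℕ → ℕ → ℕ
D′ zero zero = 1
D′ zero (suc zero) = D′ zero zero
D′ zero (suc (suc b)) = D′ zero (suc b) ℕ.+ D′ zero b
D′ (suc a) zero = D′ a zero
D′ (suc a) (suc zero) = D′ a (suc zero) ℕ.+ D′ a zero ℕ.+ D′ (suc a) zero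
D′ (suc a) (suc (suc b)) =
  D′ a (suc (suc b)) ℕ.+ D′ a (suc b) ℕ.+ D′ (suc a) (suc b) ℕ.+ D′ (suc a) b

-- Polynomials with integer coefficients as coefficient lists,
-- lowest degree first: c₀ ∷ c₁ ∷ … represents c₀ + c₁ x + …
Poly : Set
Poly = List ℤ

_⊖_ : Poly → Poly → Poly
[] ⊖ [] = []
[] ⊖ (q ∷ qs) = (0ℤ - q) ∷ ([] ⊖ qs)
(p ∷ ps) ⊖ [] = p ∷ ps
(p ∷ ps) ⊖ (q ∷ qs) = (p - q) ∷ (ps ⊖ qs)

x²* : Poly → Poly
x²* p = 0ℤ ∷ 0ℤ ∷ p

-- Leading coefficient: the coefficient of the highest power of x with a
-- nonzero coefficient (0 for the zero polynomial).
leadingCoeff : Poly → ℤ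
leadingCoeff [] = 0ℤ
leadingCoeff (c ∷ cs) with leadingCoeff cs ≟ 0ℤ
... | yes _ = c
... | no  _ = leadingCoeff cs

𝓗 : ℕ → Poly
𝓗 zero = []
𝓗 (suc m) = map (λ k → + D′ (m ∸ k) k) (upTo (suc m))

-- 𝓗̃_n(x) = 𝓗_n(x) - x² 𝓗_{n-2}(x)   (𝓗_{n-2} = 0 when n - 2 ≤ 0,
-- which is what 𝓗 (n ∸ 2) gives for n ≤ 2).
𝓗̃ : ℕ → Poly
𝓗̃ n = 𝓗 n ⊖ x²* (𝓗 (n ∸ 2))

-- The top coefficient of 𝓗_{m+1} is D'(0,m), which counts the paths up the y-axis by
-- steps of length 1 and 2, i.e. f_{m+1}. In 𝓗̃_{m+3} = 𝓗_{m+3} - x²𝓗_{m+1} both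
-- polynomials have degree m+2, so the top coefficient is f_{m+3} - f_{m+1} = f_{m+2}.
module Submission where

open import Defs
open import Data.Nat using (ℕ; zero; suc; _∸_; _≥_; _<_; z≤n; s≤s)
import Data.Nat as ℕ
open import Data.Nat.Properties using (n∸n≡0; suc-injective; <⇒≢; <-≤-trans; m≤m+n)
open import Data.Integer using (ℤ; +_; 0ℤ; _+_; _-_; _≟_)
open import Data.Integer.Properties using (+-injective; pos-+; +-0-abelianGroup)
open import Algebra.Properties.AbelianGroup +-0-abelianGroup using (//-rightDividesʳ)
open import Data.List using ([]; _∷_; _∷ʳ_; map; upTo; applyUpTo; length)
open import Data.List.Properties using (map-upTo; applyUpTo-∷ʳ; length-applyUpTo)
open import Data.Product using (_×_; _,_)
open import Data.Empty using (⊥-elim)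
open import Relation.Nullary using (yes; no)
open import Relation.Binary.PropositionalEquality
  using (_≡_; _≢_; refl; sym; trans; cong; cong₂; module ≡-Reasoning)
open ≡-Reasoning

leadingCoeff-∷ʳ : ∀ cs {c} → c ≢ 0ℤ → leadingCoeff (cs ∷ʳ c) ≡ c
leadingCoeff-∷ʳ []           c≢0 = refl
leadingCoeff-∷ʳ (_ ∷ cs) {c} c≢0 with leadingCoeff (cs ∷ʳ c) ≟ 0ℤ
... | yes lc≡0 = ⊥-elim (c≢0 (trans (sym (leadingCoeff-∷ʳ cs c≢0)) lc≡0))
... | no  _    = leadingCoeff-∷ʳ cs c≢0

⊖-∷ʳ : ∀ (ps qs : Poly) p q → length ps ≡ length qs →
       (ps ∷ʳ p) ⊖ (qs ∷ʳ q) ≡ (ps ⊖ qs) ∷ʳ (p - q)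
⊖-∷ʳ []       []       p q _  = refl
⊖-∷ʳ (p′ ∷ ps) (q′ ∷ qs) p q eq = cong ((p′ - q′) ∷_) (⊖-∷ʳ ps qs p q (suc-injective eq))

fib-suc-pos : ∀ n → 0 < fib (suc n)
fib-suc-pos zero    = s≤s z≤n
fib-suc-pos (suc n) = <-≤-trans (fib-suc-pos n) (m≤m+n (fib (suc n)) (fib n))

+fib-suc≢0 : ∀ n → + fib (suc n) ≢ 0ℤ
+fib-suc≢0 n eq = <⇒≢ (fib-suc-pos n) (sym (+-injective eq))

+fib-difference : ∀ n → + fib (suc (suc n)) - + fib n ≡ + fib (suc n)
+fib-difference n = begin
  + (fib (suc n) ℕ.+ fib n) - + fib n  ≡⟨ cong (_- + fib n) (pos-+ (fib (suc n)) (fib n)) ⟩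
  + fib (suc n) + + fib n - + fib n    ≡⟨ //-rightDividesʳ (+ fib n) (+ fib (suc n)) ⟩
  + fib (suc n)                        ∎

D′-zero : ∀ b → D′ 0 b ≡ fib (suc b)
D′-zero zero          = refl
D′-zero (suc zero)    = refl
D′-zero (suc (suc b)) = cong₂ ℕ._+_ (D′-zero (suc b)) (D′-zero b)

coeff : ℕ → ℕ → ℤ
coeff m k = + D′ (m ∸ k) k

lowerCoeffs : ℕ → Poly
lowerCoeffs m = applyUpTo (coeff m) m

𝓗-suc : ∀ m → 𝓗 (suc m) ≡ lowerCoeffs m ∷ʳ + fib (suc m)
𝓗-suc m = begin
  map (coeff m) (upTo (suc m))       ≡⟨ map-upTo (coeff m) (suc m) ⟩
  applyUpTo (coeff m) (suc m)        ≡⟨ applyUpTo-∷ʳ (coeff m) m ⟨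
  lowerCoeffs m ∷ʳ + D′ (m ∸ m) m    ≡⟨ cong (λ d → lowerCoeffs m ∷ʳ + D′ d m) (n∸n≡0 m) ⟩
  lowerCoeffs m ∷ʳ + D′ 0 m          ≡⟨ cong (λ d → lowerCoeffs m ∷ʳ + d) (D′-zero m) ⟩
  lowerCoeffs m ∷ʳ + fib (suc m)     ∎

leadingCoeff-𝓗-suc : ∀ m → leadingCoeff (𝓗 (suc m)) ≡ + fib (suc m)
leadingCoeff-𝓗-suc m = trans (cong leadingCoeff (𝓗-suc m)) (leadingCoeff-∷ʳ (lowerCoeffs m) (+fib-suc≢0 m))

lowerDifference : ℕ → Poly
lowerDifference m = lowerCoeffs (suc (suc m)) ⊖ x²* (lowerCoeffs m)

𝓗̃-suc³ : ∀ m → 𝓗̃ (suc (suc (suc m))) ≡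
          lowerDifference m ∷ʳ (+ fib (suc (suc (suc m))) - + fib (suc m))
𝓗̃-suc³ m = trans (cong₂ _⊖_ (𝓗-suc (suc (suc m))) (cong x²* (𝓗-suc m)))
                  (⊖-∷ʳ (lowerCoeffs (suc (suc m))) (x²* (lowerCoeffs m)) _ _ equalLength)
  where
  equalLength : length (lowerCoeffs (suc (suc m))) ≡ length (x²* (lowerCoeffs m))
  equalLength = trans (length-applyUpTo (coeff (suc (suc m))) (suc (suc m)))
                      (cong (λ l → suc (suc l)) (sym (length-applyUpTo (coeff m) m)))

leadingCoeff-𝓗̃-suc³ : ∀ m → leadingCoeff (𝓗̃ (suc (suc (suc m)))) ≡ + fib (suc (suc m))
leadingCoeff-𝓗̃-suc³ m = begin
  leadingCoeff (𝓗̃ (suc (suc (suc m))))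
    ≡⟨ cong leadingCoeff (𝓗̃-suc³ m) ⟩
  leadingCoeff (lowerDifference m ∷ʳ (+ fib (suc (suc (suc m))) - + fib (suc m)))
    ≡⟨ leadingCoeff-∷ʳ (lowerDifference m) top≢0 ⟩
  + fib (suc (suc (suc m))) - + fib (suc m)
    ≡⟨ +fib-difference (suc m) ⟩
  + fib (suc (suc m)) ∎
  where
  top≢0 : + fib (suc (suc (suc m))) - + fib (suc m) ≢ 0ℤ
  top≢0 eq = +fib-suc≢0 (suc m) (trans (sym (+fib-difference (suc m))) eq)

corollary4p3 : (n : ℕ) → n ≥ 1 →
    (leadingCoeff (𝓗 n) ≡ + fib n) × (leadingCoeff (𝓗̃ (suc n)) ≡ + fib n)
corollary4p3 (suc zero)    _ = refl , refl
corollary4p3 (suc (suc m)) _ = leadingCoeff-𝓗-suc (suc m) , leadingCoeff-𝓗̃-suc³ m
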